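{- If a graph $G$ is in $\mathcal{R}_{UVR}$ (and has maximum degree at least $2$, so that $b_R(G)$ is defined), then $b_R(G)\le\delta(G)$.
   Context: All graphs are finite, simple and undirected. A Roman dominating function (RDF) on $G$ is a map $f:V(G)\to\{0,1,2\}$ such that every vertex with $f$-value $0$ has a neighbor with $f$-value $2$; its weight is $\sum_v f(v)$ and $\gamma_R(G)$ is the minimum weight of an RDF. $\mathcal{R}_{UVR}$ is the class of graphs $G$ with $\gamma_R(G-v)=\gamma_R(G)$ for all $v\in V(G)$. For $G$ with maximum degree at least $2$, the Roman bondage number $b_R(G)$ is the minimum cardinality of a set $E_1\subseteq E(G)$ with $\gamma_R(G-E_1)>\gamma_R(G)$. $\delta(G)$ is the minimum degree of $G$. -}

module Defs where

open import Data.Nat using (ℕ; zero; suc; _+_; _≤_; _<_; _⊔_; _⊓_)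
open import Data.Bool using (Bool; true; false; _∧_; not; T)
open import Data.Fin using (Fin; toℕ; punchIn) renaming (zero to fzero)
open import Data.List using (List; length; filter; allFin; cartesianProduct; map; foldr)
open import Data.Nat.ListAction using (sum)
open import Data.Product using (_×_; _,_; ∃; Σ; proj₁; proj₂)
open import Relation.Binary.PropositionalEquality using (_≡_; refl; cong₂)
open import Relation.Nullary.Decidable using (Dec)
open import Data.Bool using (_≟_)
open import Data.Nat using (_<ᵇ_)

record Graph (n : ℕ) : Set where
  field
    adj   : Fin n → Fin n → Bool
    sym   : ∀ i j → adj i j ≡ adj j i
    irrefl : ∀ i → adj i i ≡ false
open Graph public

countT : ∀ {n} → (Fin n → Bool) → ℕ
countT {n} p = length (filter (λ i → p i ≟ true) (allFin n))

degree : ∀ {n} → Graph n → Fin n → ℕ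
degree G v = countT (adj G v)

maxDegree : ∀ {n} → Graph n → ℕ
maxDegree {n} G = foldr (λ v m → degree G v ⊔ m) 0 (allFin n)

minDegree : ∀ {m} → Graph (suc m) → ℕ
minDegree {m} G = foldr (λ v k → degree G v ⊓ k) (degree G fzero) (allFin (suc m))

IsRDF : ∀ {n} → Graph n → (Fin n → Fin 3) → Set
IsRDF {n} G f = ∀ v → toℕ (f v) ≡ 0 → ∃ λ u → (T (adj G v u) × toℕ (f u) ≡ 2)

weight : ∀ {n} → (Fin n → Fin 3) → ℕ
weight {n} f = sum (map (λ v → toℕ (f v)) (allFin n))

IsRomanDomNumber : ∀ {n} → Graph n → ℕ → Set
IsRomanDomNumber {n} G k =
  (Σ (Fin n → Fin 3) λ f → IsRDF G f × weight f ≡ k)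
  × (∀ (f : Fin n → Fin 3) → IsRDF G f → k ≤ weight f)

deleteVertex : ∀ {m} → Graph (suc m) → Fin (suc m) → Graph m
deleteVertex G v = record
  { adj = λ i j → adj G (punchIn v i) (punchIn v j)
  ; sym = λ i j → sym G (punchIn v i) (punchIn v j)
  ; irrefl = λ i → irrefl G (punchIn v i) }

InRUVR : ∀ {m} → Graph (suc m) → Set
InRUVR {m} G = ∀ (v : Fin (suc m)) (k k' : ℕ) →
  IsRomanDomNumber G k → IsRomanDomNumber (deleteVertex G v) k' → k' ≡ k

record EdgeSubset {n} (G : Graph n) : Set where
  field
    mem    : Fin n → Fin n → Bool
    memSym : ∀ i j → mem i j ≡ mem j i
    memSub : ∀ i j → T (mem i j) → T (adj G i j)
open EdgeSubset public

-- |E₁|: number of unordered pairs {i,j} (counted once, with i < j) in E₁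
edgeCount : ∀ {n} {G : Graph n} → EdgeSubset G → ℕ
edgeCount {n} E₁ =
  length (filter (λ p → ((toℕ (proj₁ p) <ᵇ toℕ (proj₂ p))
                          ∧ mem E₁ (proj₁ p) (proj₂ p)) ≟ true)
                 (cartesianProduct (allFin n) (allFin n)))

deleteEdges : ∀ {n} (G : Graph n) → EdgeSubset G → Graph n
deleteEdges G E₁ = record
  { adj = λ i j → adj G i j ∧ not (mem E₁ i j)
  ; sym = λ i j → helper i j
  ; irrefl = λ i → irr i }
  where
  helper : ∀ i j → (adj G i j ∧ not (mem E₁ i j)) ≡ (adj G j i ∧ not (mem E₁ j i))
  helper i j = cong₂ (λ a b → a ∧ not b) (sym G i j) (memSym E₁ i j)
  irr : ∀ i → (adj G i i ∧ not (mem E₁ i i)) ≡ false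
  irr i rewrite irrefl G i = refl

-- b_R(G) ≤ k  iff  some E₁ ⊆ E(G) with |E₁| ≤ k has γ_R(G - E₁) > γ_R(G)
RomanBondageAtMost : ∀ {n} → Graph n → ℕ → Set
RomanBondageAtMost G k =
  Σ (EdgeSubset G) λ E₁ → edgeCount E₁ ≤ k ×
    (∀ r r' → IsRomanDomNumber G r → IsRomanDomNumber (deleteEdges G E₁) r' → r < r')

-- Let v be a vertex of minimum degree and E₁ the set of δ(G) edges at v.
-- In G - E₁ the vertex v is isolated, so every Roman dominating function
-- g of G - E₁ has g(v) ≥ 1, and g restricted to G - v is Roman dominating
-- there. Hence γ_R(G - E₁) ≥ 1 + γ_R(G - v) = 1 + γ_R(G), the last step
-- being the hypothesis G ∈ R_UVR.
module Submission where

open import Defs hiding (sym)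
open import Data.Nat using (ℕ; zero; suc; _+_; _≤_; _<_; _<ᵇ_; _⊓_; z≤n)
open import Data.Nat.Properties
open import Data.Nat.Induction using (<-rec)
import Data.Nat.ListAction as List
open import Data.Bool as Bool using (Bool; true; false; _∧_; _∨_; not; T)
open import Data.Bool.Properties using (T-∧; T-∨; T-not-≡; ∨-comm)
open import Data.Fin using (Fin; toℕ; punchIn; punchOut) renaming (zero to fzero; suc to fsuc)
open import Data.Fin.Properties using (any?; all?; punchInᵢ≢i; punchIn-punchOut) renaming (_≟_ to _≟ᶠ_)
import Data.Vec.Functional as Vector
open import Data.Vec.Functional using (Vector; head; tail)
open import Data.Vec.Functional.Properties using (∷-cong)
open import Data.List using (List; []; _∷_; length; filter; allFin; cartesianProduct; map; foldr; tabulate; _++_)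
open import Data.List.Properties using (map-tabulate; map-cong; map-∘; map-++)
open import Data.Nat.ListAction.Properties using (sum-++)
open import Algebra.Properties.CommutativeMonoid.Sum +-0-commutativeMonoid
  using (sum; sum-syntax; sum-remove; ∑-distrib-+; sum-cong-≗; sum-replicate-zero)
open import Data.Product using (_×_; _,_; ∃; Σ; proj₁; proj₂)
open import Data.Sum as Sum using (_⊎_; inj₁; inj₂; [_,_])
open import Data.Unit using (tt)
open import Data.Empty using (⊥; ⊥-elim)
open import Function using (_∘_; id; Equivalence)
open import Relation.Binary.Definitions using (_Respects_)
open import Relation.Nullary using (¬_; Dec; yes; no)
open import Relation.Nullary.Decidable using (⌊_⌋; map′; T?; _×-dec_; _→-dec_; toWitness; fromWitness)
open import Relation.Unary using (Pred; Decidable)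
open import Level using (0ℓ)
open import Relation.Binary.PropositionalEquality using (_≡_; _≢_; _≗_; refl; sym; trans; cong; cong₂; subst; module ≡-Reasoning)

open Equivalence using (to; from)

𝟙 : Bool → ℕ
𝟙 true  = 1
𝟙 false = 0

𝟙-mono : ∀ {a b} → (T a → T b) → 𝟙 a ≤ 𝟙 b
𝟙-mono {false}          _ = z≤n
𝟙-mono {true}  {true}   _ = ≤-refl
𝟙-mono {true}  {false} ab = ⊥-elim (ab tt)

𝟙-≡0 : ∀ {a} → ¬ T a → 𝟙 a ≡ 0
𝟙-≡0 {false} _ = refl
𝟙-≡0 {true} ¬a = ⊥-elim (¬a tt)

𝟙-∧-disjoint : ∀ a b c → (T a → T b → ⊥) → 𝟙 (a ∧ c) + 𝟙 (b ∧ c) ≤ 𝟙 c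
𝟙-∧-disjoint true  true  c ¬ab = ⊥-elim (¬ab tt tt)
𝟙-∧-disjoint true  false c _   = ≤-reflexive (+-identityʳ (𝟙 c))
𝟙-∧-disjoint false b     c _   = 𝟙-mono (proj₂ ∘ to T-∧)

∑-mono-≤ : ∀ {n} {f g : Vector ℕ n} → (∀ i → f i ≤ g i) → sum f ≤ sum g
∑-mono-≤ {zero}  _   = z≤n
∑-mono-≤ {suc n} f≤g = +-mono-≤ (f≤g fzero) (∑-mono-≤ (f≤g ∘ fsuc))

∑-concentrated : ∀ {n} (v : Fin (suc n)) (f : Vector ℕ (suc n)) →
  (∀ i → f (punchIn v i) ≡ 0) → sum f ≡ f v
∑-concentrated {n} v f vanishes = begin
  sum f                     ≡⟨ sum-remove {i = v} f ⟩
  f v + sum (f ∘ punchIn v) ≡⟨ cong (f v +_) (trans (sum-cong-≗ vanishes) (sum-replicate-zero n)) ⟩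
  f v + 0                   ≡⟨ +-identityʳ (f v) ⟩
  f v                       ∎
  where open ≡-Reasoning

length-filter-≡true : ∀ {A : Set} (b : A → Bool) (xs : List A) →
  length (filter (λ x → b x Bool.≟ true) xs) ≡ List.sum (map (𝟙 ∘ b) xs)
length-filter-≡true b []       = refl
length-filter-≡true b (x ∷ xs) with b x
... | true  = cong suc (length-filter-≡true b xs)
... | false = length-filter-≡true b xs

sum-tabulate : ∀ {n} (f : Vector ℕ n) → List.sum (tabulate f) ≡ sum f
sum-tabulate {zero}  f = refl
sum-tabulate {suc n} f = cong (f fzero +_) (sum-tabulate (f ∘ fsuc))

sum-allFin : ∀ {n} (f : Vector ℕ n) → List.sum (map f (allFin n)) ≡ sum f
sum-allFin f = trans (cong List.sum (map-tabulate id f)) (sum-tabulate f)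

sum-cartesianProduct : ∀ {A B : Set} (g : A × B → ℕ) (xs : List A) (ys : List B) →
  List.sum (map g (cartesianProduct xs ys)) ≡ List.sum (map (λ x → List.sum (map (λ y → g (x , y)) ys)) xs)
sum-cartesianProduct g []       ys = refl
sum-cartesianProduct g (x ∷ xs) ys = begin
  List.sum (map g (map (x ,_) ys ++ cartesianProduct xs ys))
    ≡⟨ cong List.sum (map-++ g (map (x ,_) ys) _) ⟩
  List.sum (map g (map (x ,_) ys) ++ map g (cartesianProduct xs ys))
    ≡⟨ sum-++ (map g (map (x ,_) ys)) _ ⟩
  List.sum (map g (map (x ,_) ys)) + List.sum (map g (cartesianProduct xs ys))
    ≡⟨ cong₂ _+_ (cong List.sum (sym (map-∘ ys))) (sum-cartesianProduct g xs ys) ⟩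
  List.sum (map (λ y → g (x , y)) ys) + List.sum (map (λ x → List.sum (map (λ y → g (x , y)) ys)) xs) ∎
  where open ≡-Reasoning

countT-∑ : ∀ {n} (p : Fin n → Bool) → countT p ≡ ∑[ i < n ] 𝟙 (p i)
countT-∑ {n} p = trans (length-filter-≡true p (allFin n)) (sum-allFin (𝟙 ∘ p))

weight-∑ : ∀ {n} (f : Fin n → Fin 3) → weight f ≡ ∑[ i < n ] toℕ (f i)
weight-∑ f = sum-allFin (toℕ ∘ f)

edgeCount-∑ : ∀ {n} {G : Graph n} (E₁ : EdgeSubset G) →
  edgeCount E₁ ≡ ∑[ i < n ] ∑[ j < n ] 𝟙 ((toℕ i <ᵇ toℕ j) ∧ mem E₁ i j)
edgeCount-∑ {n} E₁ = begin
  edgeCount E₁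
    ≡⟨ length-filter-≡true upper (cartesianProduct (allFin n) (allFin n)) ⟩
  List.sum (map (𝟙 ∘ upper) (cartesianProduct (allFin n) (allFin n)))
    ≡⟨ sum-cartesianProduct (𝟙 ∘ upper) (allFin n) (allFin n) ⟩
  List.sum (map (λ i → List.sum (map (λ j → 𝟙 (upper (i , j))) (allFin n))) (allFin n))
    ≡⟨ cong List.sum (map-cong (λ i → sum-allFin (λ j → 𝟙 (upper (i , j)))) (allFin n)) ⟩
  List.sum (map (λ i → ∑[ j < n ] 𝟙 (upper (i , j))) (allFin n))
    ≡⟨ sum-allFin (λ i → ∑[ j < n ] 𝟙 (upper (i , j))) ⟩
  ∑[ i < n ] ∑[ j < n ] 𝟙 (upper (i , j)) ∎
  where
  open ≡-Reasoning
  upper : Fin n × Fin n → Bool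
  upper (i , j) = (toℕ i <ᵇ toℕ j) ∧ mem E₁ i j

-- Without function extensionality, deciding ∃ over vectors-as-functions
-- needs the predicate to respect pointwise equality.
∃-vector? : ∀ {k} n {P : Vector (Fin k) n → Set} → P Respects _≗_ → Decidable P → Dec (∃ P)
∃-vector? zero    resp P? = map′ (Vector.[] ,_) (λ (f , Pf) → resp (λ ()) Pf) (P? Vector.[])
∃-vector? (suc n) resp P? =
  map′ (λ (a , t , Pat) → a Vector.∷ t , Pat)
       (λ (f , Pf) → head f , tail f , resp (∷-cong refl λ _ → refl) Pf)
       (any? λ a → ∃-vector? n (λ t≗u → resp (∷-cong refl t≗u)) (P? ∘ (a Vector.∷_)))

LeastWitness : Pred ℕ 0ℓ → Set
LeastWitness P = ∃ λ k → P k × (∀ {j} → P j → k ≤ j)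

leastWitness : ∀ {P} → Decidable P → ∀ {w} → P w → LeastWitness P
leastWitness {P} P? = <-rec (λ w → P w → LeastWitness P) search _
  where
  search : ∀ w → (∀ {u} → u < w → P u → LeastWitness P) → P w → LeastWitness P
  search w below Pw with anyUpTo? P? w
  ... | yes (u , u<w , Pu) = below u<w Pu
  ... | no ¬smaller        = w , Pw , λ {j} Pj → ≮⇒≥ λ j<w → ¬smaller (j , j<w , Pj)

module _ {n} (H : Graph n) where

  RDFOfWeight : ℕ → Set
  RDFOfWeight w = Σ (Fin n → Fin 3) λ f → IsRDF H f × weight f ≡ w

  IsRDF? : Decidable (IsRDF H)
  IsRDF? f = all? λ v → (toℕ (f v) ≟ 0) →-dec any? λ u → T? (adj H v u) ×-dec (toℕ (f u) ≟ 2)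

  IsRDF-resp-≗ : IsRDF H Respects _≗_
  IsRDF-resp-≗ f≗g rdf v gv≡0 with rdf v (trans (cong toℕ (f≗g v)) gv≡0)
  ... | u , vu , fu≡2 = u , vu , trans (cong toℕ (sym (f≗g u))) fu≡2

  weight-resp-≗ : ∀ {f g : Fin n → Fin 3} → f ≗ g → weight f ≡ weight g
  weight-resp-≗ f≗g = cong List.sum (map-cong (cong toℕ ∘ f≗g) (allFin n))

  RDFOfWeight? : Decidable RDFOfWeight
  RDFOfWeight? w = ∃-vector? n
    (λ f≗g (rdf , wf) → IsRDF-resp-≗ f≗g rdf , trans (sym (weight-resp-≗ f≗g)) wf)
    (λ f → IsRDF? f ×-dec (weight f ≟ w))

  romanDomNumber-≤ : ∀ f → IsRDF H f → ∃ λ k → IsRomanDomNumber H k × k ≤ weight f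
  romanDomNumber-≤ f rdf with leastWitness RDFOfWeight? (f , rdf , refl)
  ... | k , optimal , least = k , (optimal , λ g rdg → least (g , rdg , refl)) , least (f , rdf , refl)

record _⊆ᴳ_ {n} (H G : Graph n) : Set where
  field adj-⊆ : ∀ i j → T (adj H i j) → T (adj G i j)
open _⊆ᴳ_

record Isolated {n} (H : Graph n) (v : Fin n) : Set where
  field nonadjacent : ∀ u → ¬ T (adj H v u)
open Isolated

deleteEdges-⊆ᴳ : ∀ {n} (G : Graph n) (E₁ : EdgeSubset G) → deleteEdges G E₁ ⊆ᴳ G
deleteEdges-⊆ᴳ G E₁ .adj-⊆ i j = proj₁ ∘ to T-∧

deleteVertex-mono : ∀ {m} {H G : Graph (suc m)} (v : Fin (suc m)) → H ⊆ᴳ G → deleteVertex H v ⊆ᴳ deleteVertex G v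
deleteVertex-mono v H⊆G .adj-⊆ i j = adj-⊆ H⊆G (punchIn v i) (punchIn v j)

IsRDF-mono : ∀ {n} {H G : Graph n} {f : Fin n → Fin 3} → H ⊆ᴳ G → IsRDF H f → IsRDF G f
IsRDF-mono H⊆G rdf v fv≡0 with rdf v fv≡0
... | u , vu , fu≡2 = u , adj-⊆ H⊆G v u vu , fu≡2

isolated-value-≢0 : ∀ {n} {H : Graph n} {f : Fin n → Fin 3} {v} → Isolated H v → IsRDF H f → toℕ (f v) ≢ 0
isolated-value-≢0 isolated rdf fv≡0 with rdf _ fv≡0
... | u , vu , _ = nonadjacent isolated u vu

IsRDF-deleteIsolated : ∀ {m} {H : Graph (suc m)} {f : Fin (suc m) → Fin 3} {v} →
  Isolated H v → IsRDF H f → IsRDF (deleteVertex H v) (f ∘ punchIn v)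
IsRDF-deleteIsolated {H = H} {f} {v} isolated rdf w fw≡0 with rdf (punchIn v w) fw≡0
... | u , wu , fu≡2 with v ≟ᶠ u
...   | yes refl = ⊥-elim (nonadjacent isolated (punchIn v w) (subst T (Graph.sym H (punchIn v w) v) wu))
...   | no  v≢u  = punchOut v≢u
                 , subst (T ∘ adj H (punchIn v w)) (sym (punchIn-punchOut v≢u)) wu
                 , subst (λ x → toℕ (f x) ≡ 2) (sym (punchIn-punchOut v≢u)) fu≡2

weight-punchIn : ∀ {m} (f : Fin (suc m) → Fin 3) v → weight f ≡ toℕ (f v) + weight (f ∘ punchIn v)
weight-punchIn f v = begin
  weight f                                   ≡⟨ weight-∑ f ⟩
  sum (toℕ ∘ f)                              ≡⟨ sum-remove {i = v} (toℕ ∘ f) ⟩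
  toℕ (f v) + sum (toℕ ∘ f ∘ punchIn v)      ≡⟨ cong (toℕ (f v) +_) (weight-∑ (f ∘ punchIn v)) ⟨
  toℕ (f v) + weight (f ∘ punchIn v)         ∎
  where open ≡-Reasoning

romanDomNumber-deleteVertex-< : ∀ {m} {H G : Graph (suc m)} {v r} → H ⊆ᴳ G → Isolated H v →
  IsRomanDomNumber H r → ∃ λ k → IsRomanDomNumber (deleteVertex G v) k × k < r
romanDomNumber-deleteVertex-< {H = H} {G} {v} {r} H⊆G isolated ((g , rdg , wg≡r) , _)
  with romanDomNumber-≤ (deleteVertex G v) (g ∘ punchIn v)
         (IsRDF-mono (deleteVertex-mono v H⊆G) (IsRDF-deleteIsolated isolated rdg))
... | k , γk , k≤ = k , γk , (begin-strict
  k                                     ≤⟨ k≤ ⟩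
  weight (g ∘ punchIn v)                <⟨ +-monoˡ-≤ _ (n≢0⇒n>0 (isolated-value-≢0 isolated rdg)) ⟩
  toℕ (g v) + weight (g ∘ punchIn v)    ≡⟨ weight-punchIn g v ⟨
  weight g                              ≡⟨ wg≡r ⟩
  r                                     ∎)
  where open ≤-Reasoning

-- Every counted pair (i, j), i < j, has v as an endpoint: row v holds the
-- neighbours above v, and any other row i at most the pair (i, v) with i < v.
edgeCount-≤-degree : ∀ {m} {G : Graph (suc m)} (E₁ : EdgeSubset G) (v : Fin (suc m)) →
  (∀ i j → T (mem E₁ i j) → i ≡ v ⊎ j ≡ v) → edgeCount E₁ ≤ degree G v
edgeCount-≤-degree {m} {G} E₁ v incident = begin
  edgeCount E₁                                            ≡⟨ edgeCount-∑ E₁ ⟩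
  sum (λ i → sum (counted i))                             ≡⟨ sum-remove {i = v} (λ i → sum (counted i)) ⟩
  sum (counted v) + sum (λ i → sum (counted (punchIn v i)))
    ≤⟨ +-mono-≤ (∑-mono-≤ row-v-≤-after) (∑-mono-≤ (λ i → ≤-reflexive (other-row≡entry-at-v i))) ⟩
  sum after + sum (λ i → counted (punchIn v i) v)
    ≤⟨ +-monoʳ-≤ (sum after) (∑-mono-≤ (λ i → entry-at-v-≤-before (punchIn v i))) ⟩
  sum after + sum (before ∘ punchIn v)                    ≤⟨ +-monoʳ-≤ (sum after) (m≤n+m _ (before v)) ⟩
  sum after + (before v + sum (before ∘ punchIn v))       ≡⟨ cong (sum after +_) (sum-remove {i = v} before) ⟨
  sum after + sum before                                  ≡⟨ ∑-distrib-+ after before ⟨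
  sum (λ j → after j + before j)                          ≤⟨ ∑-mono-≤ (λ j → 𝟙-∧-disjoint _ _ (adj G v j) (v<j-asym j)) ⟩
  sum (𝟙 ∘ adj G v)                                       ≡⟨ countT-∑ (adj G v) ⟨
  degree G v                                              ∎
  where
  open ≤-Reasoning
  counted : Fin (suc m) → Fin (suc m) → ℕ
  counted i j = 𝟙 ((toℕ i <ᵇ toℕ j) ∧ mem E₁ i j)
  after before : Fin (suc m) → ℕ
  after  j = 𝟙 ((toℕ v <ᵇ toℕ j) ∧ adj G v j)
  before j = 𝟙 ((toℕ j <ᵇ toℕ v) ∧ adj G v j)

  row-v-≤-after : ∀ j → counted v j ≤ after j
  row-v-≤-after j = 𝟙-mono λ t → let (v<j , vj) = to T-∧ t in from T-∧ (v<j , memSub E₁ v j vj)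

  entry-at-v-≤-before : ∀ i → counted i v ≤ before i
  entry-at-v-≤-before i = 𝟙-mono λ t → let (i<v , iv) = to T-∧ t in
    from T-∧ (i<v , subst T (Graph.sym G i v) (memSub E₁ i v iv))

  other-row≡entry-at-v : ∀ i → sum (counted (punchIn v i)) ≡ counted (punchIn v i) v
  other-row≡entry-at-v i = ∑-concentrated v (counted (punchIn v i)) λ j →
    𝟙-≡0 λ t → [ punchInᵢ≢i v i , punchInᵢ≢i v j ] (incident _ _ (proj₂ (to T-∧ t)))

  v<j-asym : ∀ j → T (toℕ v <ᵇ toℕ j) → T (toℕ j <ᵇ toℕ v) → ⊥
  v<j-asym j v<j j<v = <-asym (<ᵇ⇒< (toℕ v) (toℕ j) v<j) (<ᵇ⇒< (toℕ j) (toℕ v) j<v)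

incidentEdges : ∀ {n} (G : Graph n) → Fin n → EdgeSubset G
incidentEdges G v = record
  { mem    = λ i j → adj G i j ∧ (⌊ i ≟ᶠ v ⌋ ∨ ⌊ j ≟ᶠ v ⌋)
  ; memSym = λ i j → cong₂ _∧_ (Graph.sym G i j) (∨-comm (⌊ i ≟ᶠ v ⌋) _)
  ; memSub = λ i j → proj₁ ∘ to T-∧
  }

incidentEdges-incident : ∀ {n} (G : Graph n) v i j → T (mem (incidentEdges G v) i j) → i ≡ v ⊎ j ≡ v
incidentEdges-incident G v i j ij∈E₁ =
  Sum.map (toWitness {a? = i ≟ᶠ v}) (toWitness {a? = j ≟ᶠ v}) (to T-∨ (proj₂ (to T-∧ ij∈E₁)))

deleteIncidentEdges-isolated : ∀ {n} (G : Graph n) v → Isolated (deleteEdges G (incidentEdges G v)) v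
deleteIncidentEdges-isolated G v .nonadjacent u vu-kept = subst T (to T-not-≡ vu∉E₁) vu∈E₁
  where
  vu∈G : T (adj G v u)
  vu∈G = proj₁ (to (T-∧ {adj G v u}) vu-kept)
  vu∉E₁ : T (not (mem (incidentEdges G v) v u))
  vu∉E₁ = proj₂ (to (T-∧ {adj G v u}) vu-kept)
  vu∈E₁ : T (mem (incidentEdges G v) v u)
  vu∈E₁ = from T-∧ (vu∈G , from T-∨ (inj₁ (fromWitness {a? = v ≟ᶠ v} refl)))

foldr-⊓-attained : ∀ {A : Set} (d : A → ℕ) z (xs : List A) → ∃ λ v → foldr (λ v k → d v ⊓ k) (d z) xs ≡ d v
foldr-⊓-attained d z []       = z , refl
foldr-⊓-attained d z (x ∷ xs) with ⊓-sel (d x) (foldr (λ v k → d v ⊓ k) (d z) xs)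
... | inj₁ ≡dx   = x , ≡dx
... | inj₂ ≡rest = let (v , ≡dv) = foldr-⊓-attained d z xs in v , trans ≡rest ≡dv

minDegree-attained : ∀ {m} (G : Graph (suc m)) → ∃ λ v → minDegree G ≡ degree G v
minDegree-attained {m} G = foldr-⊓-attained (degree G) fzero (allFin (suc m))

-- The hypothesis Δ(G) ≥ 2 only makes b_R(G) defined; the bound does not need it.
mainTheorem5 : ∀ {m} (G : Graph (suc m)) → InRUVR G → 2 ≤ maxDegree G →
    RomanBondageAtMost G (minDegree G)
mainTheorem5 G uvr _ with minDegree-attained G
... | v , δ≡deg = E₁ , |E₁|≤δ , γ-increases
  where
  E₁ : EdgeSubset G
  E₁ = incidentEdges G v
  |E₁|≤δ : edgeCount E₁ ≤ minDegree G
  |E₁|≤δ = subst (edgeCount E₁ ≤_) (sym δ≡deg) (edgeCount-≤-degree E₁ v (incidentEdges-incident G v))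
  γ-increases : ∀ r r' → IsRomanDomNumber G r → IsRomanDomNumber (deleteEdges G E₁) r' → r < r'
  γ-increases r r' γr γr' with romanDomNumber-deleteVertex-< (deleteEdges-⊆ᴳ G E₁) (deleteIncidentEdges-isolated G v) γr'
  ... | k , γk , k<r' = subst (_< r') (uvr v r k γr γk) k<r'
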